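{- Let $t$ be a term. (1) $t$ is $\bar{\mathsf{sh}}$-normal if and only if $t\in\Lambda_n$. (2) $t$ is $\bar{\mathsf{sh}}$-normal and is neither a value nor a $\beta$-redex if and only if $t\in\Lambda_a$.
   Context: Terms: $t ::= x \mid \lambda x.t \mid tu$ up to $\alpha$-conversion; values $v ::= x\mid\lambda x.t$. A $\beta$-redex is a term of the form $(\lambda x.t)u$. Balanced contexts: $B ::= [\cdot] \mid (\lambda x.B)t \mid Bt \mid tB$. Root rules: $(\lambda x.t)v \mapsto_{\beta_v} t\{v/x\}$ ($v$ value); $(\lambda x.t)us \mapsto_{\sigma_1} (\lambda x.ts)u$ if $x\notin\mathrm{fv}(s)$; $v((\lambda x.s)u) \mapsto_{\sigma_3} (\lambda x.vs)u$ if $v$ value and $x\notin\mathrm{fv}(v)$. $\to_{\bar{\mathsf{sh}}}$ is the closure of the union of these rules under balanced contexts; $t$ is $\bar{\mathsf{sh}}$-normal if no $\to_{\bar{\mathsf{sh}}}$-step applies to it. The sets $\Lambda_a$ and $\Lambda_n$ are defined by mutual induction: $a ::= xv \mid xa \mid an$ and $n ::= v \mid a \mid (\lambda x.n)a$, where $x$ ranges over variables and $v$ over values. -}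

module Defs where

-- Untyped λ-terms up to α-conversion, represented with de Bruijn indices
-- (index 0 = innermost binder).  α-equivalence is syntactic equality here.

open import Data.Nat using (ℕ; zero; suc; pred; _<ᵇ_; _≡ᵇ_)
open import Data.Bool using (if_then_else_)
open import Data.Product using (∃; ∃-syntax; _×_)
open import Relation.Binary.PropositionalEquality using (_≡_)
open import Relation.Nullary using (¬_)

data Tm : Set where
  var : ℕ → Tm
  lam : Tm → Tm
  app : Tm → Tm → Tm

shift : ℕ → Tm → Tm
shift c (var k) = if k <ᵇ c then var k else var (suc k)
shift c (lam t) = lam (shift (suc c) t)
shift c (app t u) = app (shift c t) (shift c u)

-- ↑ t : weakening of t under one new binder.  A term under the binder λx
-- of the form ↑ s is exactly the term s with x ∉ fv(s).
↑ : Tm → Tm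
↑ = shift 0

-- subst j s t : capture-avoiding substitution t{s/x} where x is index j;
-- indices above j are decremented (the binder of x disappears).
subst : ℕ → Tm → Tm → Tm
subst j s (var k) = if k ≡ᵇ j then s else (if k <ᵇ j then var k else var (pred k))
subst j s (lam t) = lam (subst (suc j) (↑ s) t)
subst j s (app t u) = app (subst j s t) (subst j s u)

data Value : Tm → Set where
  vvar : ∀ k → Value (var k)
  vlam : ∀ t → Value (lam t)

BetaRedex : Tm → Set
BetaRedex t = ∃[ b ] ∃[ u ] (t ≡ app (lam b) u)

data _↦_ : Tm → Tm → Set where
  βv : ∀ t v → Value v → app (lam t) v ↦ subst 0 v t
  -- (λx.t)u s ↦ (λx.ts)u   (x ∉ fv(s))
  σ1 : ∀ t u s → app (app (lam t) u) s ↦ app (lam (app t (↑ s))) u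
  -- v((λx.s)u) ↦ (λx.vs)u   (v value, x ∉ fv(v))
  σ3 : ∀ v s u → Value v → app v (app (lam s) u) ↦ app (lam (app (↑ v) s)) u

data _→sh_ : Tm → Tm → Set where
  root : ∀ {t t'} → t ↦ t' → t →sh t'
  lamB : ∀ {t t'} s → t →sh t' → app (lam t) s →sh app (lam t') s
  appL : ∀ {t t'} s → t →sh t' → app t s →sh app t' s
  appR : ∀ {t t'} s → t →sh t' → app s t →sh app s t'

Normal : Tm → Set
Normal t = ∀ t' → ¬ (t →sh t')

data Λa : Tm → Set
data Λn : Tm → Set

data Λa where
  xv : ∀ k {v} → Value v → Λa (app (var k) v)
  xa : ∀ k {a} → Λa a → Λa (app (var k) a)
  an : ∀ {a n} → Λa a → Λn n → Λa (app a n)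

data Λn where
  nv   : ∀ {v} → Value v → Λn v
  na   : ∀ {a} → Λa a → Λn a
  nred : ∀ {n a} → Λn n → Λa a → Λn (app (lam n) a)

-- Soundness is a case analysis on the rules: a step at the root of a term in Λa or
-- Λn would need a value or a β-redex exactly where the grammar places a term of Λa,
-- and a step inside a balanced context lands in a subterm covered by the grammar.
-- Completeness goes by structural induction: each of βv, σ1 and σ3 that fails to
-- fire says that some immediate subterm is not a value or not a β-redex, which is
-- precisely the side information needed to place it in Λa.
module Submission where

open import Defs
open import Data.Product using (_×_; _,_)
open import Data.Empty using (⊥-elim)
open import Function.Bundles using (_⇔_; mk⇔)
open import Relation.Nullary using (¬_; Dec; yes; no)
open import Relation.Binary.PropositionalEquality using (refl)

value? : ∀ t → Dec (Value t)
value? (var k)   = yes (vvar k)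
value? (lam t)   = yes (vlam t)
value? (app t u) = no λ ()

Value⇒Normal : ∀ {v} → Value v → Normal v
Value⇒Normal (vvar k) _ (root ())
Value⇒Normal (vlam t) _ (root ())

Λa⇒¬Value : ∀ {t} → Λa t → ¬ Value t
Λa⇒¬Value (xv _ _) ()
Λa⇒¬Value (xa _ _) ()
Λa⇒¬Value (an _ _) ()

Λa⇒¬BetaRedex : ∀ {t} → Λa t → ¬ BetaRedex t
Λa⇒¬BetaRedex (xv _ _) (_ , _ , ())
Λa⇒¬BetaRedex (xa _ _) (_ , _ , ())
Λa⇒¬BetaRedex (an a _) (t , _ , refl) = Λa⇒¬Value a (vlam t)

Λa⇒Normal : ∀ {t} → Λa t → Normal t
Λn⇒Normal : ∀ {t} → Λn t → Normal t

Λa⇒Normal (xv k ())  _ (root (σ3 _ _ _ _))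
Λa⇒Normal (xv k v)   _ (appL _ (root ()))
Λa⇒Normal (xv k v)   _ (appR _ s)              = Value⇒Normal v _ s
Λa⇒Normal (xa k a)   _ (root (σ3 _ t u _))     = Λa⇒¬BetaRedex a (t , u , refl)
Λa⇒Normal (xa k a)   _ (appL _ (root ()))
Λa⇒Normal (xa k a)   _ (appR _ s)              = Λa⇒Normal a _ s
Λa⇒Normal (an a n)   _ (root (βv t _ _))       = Λa⇒¬Value a (vlam t)
Λa⇒Normal (an a n)   _ (root (σ1 t u _))       = Λa⇒¬BetaRedex a (t , u , refl)
Λa⇒Normal (an a n)   _ (root (σ3 _ _ _ v))     = Λa⇒¬Value a v
Λa⇒Normal (an a n)   _ (lamB _ _)              = Λa⇒¬Value a (vlam _)
Λa⇒Normal (an a n)   _ (appL _ s)              = Λa⇒Normal a _ s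
Λa⇒Normal (an a n)   _ (appR _ s)              = Λn⇒Normal n _ s

Λn⇒Normal (nv v)     = Value⇒Normal v
Λn⇒Normal (na a)     = Λa⇒Normal a
Λn⇒Normal (nred n a) _ (root (βv _ _ v))       = Λa⇒¬Value a v
Λn⇒Normal (nred n a) _ (root (σ3 _ t u _))     = Λa⇒¬BetaRedex a (t , u , refl)
Λn⇒Normal (nred n a) _ (lamB _ s)              = Λn⇒Normal n _ s
Λn⇒Normal (nred n a) _ (appL _ (root ()))
Λn⇒Normal (nred n a) _ (appR _ s)              = Λa⇒Normal a _ s

Normal-appˡ : ∀ {t u} → Normal (app t u) → Normal t
Normal-appˡ nf _ s = nf _ (appL _ s)

Normal-appʳ : ∀ {t u} → Normal (app t u) → Normal u
Normal-appʳ nf _ s = nf _ (appR _ s)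

Normal-redex-body : ∀ {t u} → Normal (app (lam t) u) → Normal t
Normal-redex-body nf _ s = nf _ (lamB _ s)

Normal-redex⇒¬Value-argument : ∀ {t u} → Normal (app (lam t) u) → ¬ Value u
Normal-redex⇒¬Value-argument nf v = nf _ (root (βv _ _ v))

Normal-app⇒¬BetaRedex-head : ∀ {t u} → Normal (app t u) → ¬ BetaRedex t
Normal-app⇒¬BetaRedex-head nf (t , u , refl) = nf _ (root (σ1 t u _))

Normal-value-app⇒¬BetaRedex-argument : ∀ {v u} → Value v → Normal (app v u) → ¬ BetaRedex u
Normal-value-app⇒¬BetaRedex-argument v nf (t , u , refl) = nf _ (root (σ3 _ t u v))

Normal⇒Λa : ∀ {t} → Normal t → ¬ Value t → ¬ BetaRedex t → Λa t
Normal⇒Λn : ∀ {t} → Normal t → Λn t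

Normal⇒Λa {var k} _ ¬value _ = ⊥-elim (¬value (vvar k))
Normal⇒Λa {lam t} _ ¬value _ = ⊥-elim (¬value (vlam t))
Normal⇒Λa {app (lam t) u} _ _ ¬redex = ⊥-elim (¬redex (t , u , refl))
Normal⇒Λa {app (var k) u} nf _ _ with value? u
... | yes v = xv k v
... | no ¬v = xa k (Normal⇒Λa (Normal-appʳ nf) ¬v
                              (Normal-value-app⇒¬BetaRedex-argument (vvar k) nf))
Normal⇒Λa {app (app t₁ t₂) u} nf _ _ =
  an (Normal⇒Λa (Normal-appˡ nf) (λ ()) (Normal-app⇒¬BetaRedex-head nf))
     (Normal⇒Λn (Normal-appʳ nf))

Normal⇒Λn {var k} _ = nv (vvar k)
Normal⇒Λn {lam t} _ = nv (vlam t)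
Normal⇒Λn {app (lam t) u} nf =
  nred (Normal⇒Λn (Normal-redex-body nf))
       (Normal⇒Λa (Normal-appʳ nf) (Normal-redex⇒¬Value-argument nf)
                  (Normal-value-app⇒¬BetaRedex-argument (vlam t) nf))
Normal⇒Λn {app (var k) u} nf = na (Normal⇒Λa nf (λ ()) λ { (_ , _ , ()) })
Normal⇒Λn {app (app t₁ t₂) u} nf = na (Normal⇒Λa nf (λ ()) λ { (_ , _ , ()) })

proposition2p3 : (t : Tm) →
    (Normal t ⇔ Λn t) ×
    ((Normal t × ¬ Value t × ¬ BetaRedex t) ⇔ Λa t)
proposition2p3 t =
  mk⇔ Normal⇒Λn Λn⇒Normal ,
  mk⇔ (λ { (nf , ¬value , ¬redex) → Normal⇒Λa nf ¬value ¬redex })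
      (λ a → Λa⇒Normal a , Λa⇒¬Value a , Λa⇒¬BetaRedex a)
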